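{- Let $\mathbb{F}_2^{n-1}$ be identified with a hyperplane of $\mathbb{F}_2^n$ and fix $e_0\in\mathbb{F}_2^n\setminus\mathbb{F}_2^{n-1}$. Let $f,g\colon\mathbb{F}_2^{n-1}\to\mathbb{F}_2^m$ be quadratic APN functions with $g(x)=f(x)+L(x)+c$, where $L\colon\mathbb{F}_2^{n-1}\to\mathbb{F}_2^m$ is $\mathbb{F}_2$-linear and $c\in\mathbb{F}_2^m$. Define $F\colon\mathbb{F}_2^n\to\mathbb{F}_2^m$ by $F(x):=f(x)$ and $F(x+e_0):=f(x)+L(x)+c$ for $x\in\mathbb{F}_2^{n-1}$. Then $F$ is a quadratic APN function if and only if, for every $A\in\mathbb{F}_2^{n-1}$, the mapping $\mathbb{F}_2^{n-1}\ni x\mapsto L(x)+B_f(x,A)\in\mathbb{F}_2^m$ is one-to-one.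
   Context: For a function $f\colon\mathbb{F}_2^k\to\mathbb{F}_2^m$, $B_f(x,t):=f(x+t)+f(x)+f(t)+f(0)$. The function $f$ is quadratic if $(x,t)\mapsto B_f(x,t)$ is $\mathbb{F}_2$-bilinear. $f$ is APN if for every nonzero $a\in\mathbb{F}_2^k$ and every $b\in\mathbb{F}_2^m$ the set $\{x: f(x+a)+f(x)=b\}$ has at most $2$ elements. -}

module Defs where

open import Data.Bool using (Bool; true; false; _xor_; _∧_)
open import Data.Bool.Properties using () renaming (_≟_ to _≟B_)
open import Data.Nat using (ℕ; zero; suc; _≤_)
open import Data.Vec using (Vec; []; _∷_; zipWith; replicate; map)
open import Data.Vec.Properties using (≡-dec)
open import Data.List using (List; []; _∷_; _++_; length; filter)
import Data.List as List
open import Relation.Binary.PropositionalEquality using (_≡_; _≢_)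
open import Relation.Nullary using (Dec)
open import Data.Product using (_×_)

-- 𝔽₂^k, modelled as bit vectors of length k (true = 1, xor = addition).
V : ℕ → Set
V k = Vec Bool k

infixl 6 _⊕_
_⊕_ : ∀ {k} → V k → V k → V k
_⊕_ = zipWith _xor_

𝟎 : ∀ {k} → V k
𝟎 = replicate _ false

_·_ : ∀ {k} → Bool → V k → V k
b · x = map (b ∧_) x

_≟V_ : ∀ {k} (x y : V k) → Dec (x ≡ y)
_≟V_ = ≡-dec _≟B_

IsLinear : ∀ {k m} → (V k → V m) → Set
IsLinear {k} L = (∀ (x y : V k) → L (x ⊕ y) ≡ L x ⊕ L y)
               × (∀ (b : Bool) (x : V k) → L (b · x) ≡ b · L x)

B : ∀ {k m} → (V k → V m) → V k → V k → V m
B f x t = f (x ⊕ t) ⊕ f x ⊕ f t ⊕ f 𝟎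

IsBilinear : ∀ {k m} → (V k → V k → V m) → Set
IsBilinear {k} β = (∀ (t : V k) → IsLinear (λ x → β x t))
                 × (∀ (x : V k) → IsLinear (λ t → β x t))

IsQuadratic : ∀ {k m} → (V k → V m) → Set
IsQuadratic f = IsBilinear (B f)

allV : ∀ k → List (V k)
allV zero = [] ∷ []
allV (suc k) = List.map (false ∷_) (allV k) ++ List.map (true ∷_) (allV k)

solCount : ∀ {k m} → (V k → V m) → V k → V m → ℕ
solCount {k} f a b = length (filter (λ x → (f (x ⊕ a) ⊕ f x) ≟V b) (allV k))

IsAPN : ∀ {k m} → (V k → V m) → Set
IsAPN {k} {m} f = ∀ (a : V k) → a ≢ 𝟎 → ∀ (b : V m) → solCount f a b ≤ 2

{-# OPTIONS --safe #-}

-- For quadratic h, the solutions x of h(x + a) + h(x) = b differ by elements of the kernel of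
-- x ↦ B_h(x, a), which always contains 0 and a; so a quadratic h is APN iff each of these kernels
-- (a ≠ 0) is exactly {0, a}, and the forward direction holds without quadraticity.
-- Put M_A(x) = L(x) + B_f(x, A). Writing points of 𝔽₂^n as β ∷ x, F(β ∷ x) = f(x) + β (M_v(x) + d)
-- for a constant d, whence B_F(β ∷ x, α ∷ a) = B_f(x, a) + β M_v(a) + α M_v(x). So F is quadratic,
-- and in each of the four cases for (β, α) the kernel condition for F becomes either the one for f
-- or the statement that some M_A vanishes only at 0.

module Submission where

open import Defs
open import Algebra.Bundles using (CommutativeRing)
open import Algebra.Structures using (IsCommutativeMonoid; IsCommutativeSemiring)
open import Algebra.Structures.Biased using (isCommutativeSemiringˡ)
open import Algebra.Solver.Ring.AlmostCommutativeRing
  using (AlmostCommutativeRing; fromCommutativeSemiring; _-Raw-AlmostCommutative⟶_; Induced-equivalence)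
open import Data.Bool using (Bool; true; false; _xor_; _∧_)
open import Data.Bool.Properties
  using (xor-∧-commutativeRing; ∧-isCommutativeMonoid; ∧-distribʳ-xor; ∧-zeroˡ)
  renaming (_≟_ to _≟B_)
open import Data.Empty using (⊥; ⊥-elim)
open import Data.List using (List; []; _∷_; length)
import Data.List as List
open import Data.List.Membership.Propositional using (_∈_)
open import Data.List.Membership.Propositional.Properties
  using (∈-map⁺; ∈-map⁻; ∈-++⁺ˡ; ∈-++⁺ʳ; ∈-filter⁺; ∈-filter⁻; ∈-length)
open import Data.List.Relation.Unary.Any using (here; there)
open import Data.List.Relation.Unary.All using ([]; _∷_)
open import Data.List.Relation.Unary.Unique.Propositional using (Unique; []; _∷_)
import Data.List.Relation.Unary.Unique.Propositional.Properties as Unique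
import Data.Maybe as Maybe
open import Data.Nat using (ℕ; zero; suc; _≤_; z≤n; s≤s)
open import Data.Nat.Properties using (≤-trans; <-irrefl)
open import Data.Product using (_×_; _,_; proj₁; proj₂)
open import Data.Sum using (_⊎_; inj₁; inj₂; [_,_]′)
import Data.Sum as Sum
open import Data.Vec using ([]; _∷_; replicate; zipWith)
import Data.Vec as Vec
open import Data.Vec.Properties
  using (zipWith-assoc; zipWith-comm; zipWith-identityˡ; zipWith-identityʳ; zipWith-distribʳ;
         zipWith-zeroˡ; zipWith-replicate; map-id; map-const)
open import Function using (_∘_; id)
open import Function.Bundles using (_⇔_; mk⇔; Equivalence)
open import Function.Definitions using (Injective)
open import Relation.Binary.PropositionalEquality
open import Relation.Nullary using (¬_; yes; no)
open import Relation.Unary using (Decidable)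
open import Relation.Nullary.Decidable using (dec⇒maybe)
open import Relation.Binary.Definitions using (WeaklyDecidable)

private variable
  A : Set
  k m n : ℕ

zipWith-isCommutativeMonoid : ∀ {_∙_ : A → A → A} {e : A} → IsCommutativeMonoid _≡_ _∙_ e →
  IsCommutativeMonoid _≡_ (zipWith {n = n} _∙_) (replicate n e)
zipWith-isCommutativeMonoid isCM = record
  { isMonoid = record
    { isSemigroup = record
      { isMagma = record { isEquivalence = isEquivalence ; ∙-cong = cong₂ _ }
      ; assoc = zipWith-assoc assoc }
    ; identity = zipWith-identityˡ identityˡ , zipWith-identityʳ identityʳ }
  ; comm = zipWith-comm comm }
  where open IsCommutativeMonoid isCM using (assoc; identityˡ; identityʳ; comm)

infixl 7 _*_
_*_ : V k → V k → V k
_*_ = zipWith _∧_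

-- β · y is ⟨ β ⟩ * y: scalars become ring elements, within reach of the solver.
⟨_⟩ : Bool → V k
⟨ β ⟩ = replicate _ β

⟨⟩-xor : ∀ β α → _≡_ {A = V k} ⟨ β xor α ⟩ (⟨ β ⟩ ⊕ ⟨ α ⟩)
⟨⟩-xor β α = sym (zipWith-replicate _xor_ β α)

⊕-*-isCommutativeSemiring : IsCommutativeSemiring _≡_ (_⊕_ {k}) _*_ 𝟎 ⟨ true ⟩
⊕-*-isCommutativeSemiring = isCommutativeSemiringˡ record
  { +-isCommutativeMonoid =
      zipWith-isCommutativeMonoid (CommutativeRing.+-isCommutativeMonoid xor-∧-commutativeRing)
  ; *-isCommutativeMonoid = zipWith-isCommutativeMonoid ∧-isCommutativeMonoid
  ; distribʳ = zipWith-distribʳ ∧-distribʳ-xor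
  ; zeroˡ = zipWith-zeroˡ ∧-zeroˡ }

-- Coefficients are computed in 𝔽₂, so the solver also knows that x ⊕ x ≡ 𝟎.
module ⊕-*-Solver (k : ℕ) where
  private
    ring : AlmostCommutativeRing _ _
    ring = fromCommutativeSemiring (record { isCommutativeSemiring = ⊕-*-isCommutativeSemiring {k} })

    𝔽₂ = CommutativeRing.rawRing xor-∧-commutativeRing

    constants : 𝔽₂ -Raw-AlmostCommutative⟶ ring
    constants = record
      { ⟦_⟧ = ⟨_⟩ ; +-homo = ⟨⟩-xor ; *-homo = λ β α → sym (zipWith-replicate _∧_ β α)
      ; -‿homo = λ _ → refl ; 0-homo = refl ; 1-homo = refl }

    _≟ᶜ_ : WeaklyDecidable (Induced-equivalence constants)
    β ≟ᶜ α = Maybe.map (cong ⟨_⟩) (dec⇒maybe (β ≟B α))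

  open import Algebra.Solver.Ring 𝔽₂ ring constants _≟ᶜ_ public
    using (solve; con; _:+_; _:*_; _:=_)

module _ {k : ℕ} where
  open IsCommutativeSemiring (⊕-*-isCommutativeSemiring {k}) public
    using () renaming (+-identityˡ to ⊕-identityˡ; +-identityʳ to ⊕-identityʳ; +-comm to ⊕-comm)

x⊕x≡𝟎 : ∀ (x : V k) → x ⊕ x ≡ 𝟎
x⊕x≡𝟎 {k} x = solve 1 (λ x → x :+ x := con false) refl x
  where open ⊕-*-Solver k

x⊕y⊕y≡x : ∀ (x y : V k) → x ⊕ y ⊕ y ≡ x
x⊕y⊕y≡x {k} x y = solve 2 (λ x y → x :+ y :+ y := x) refl x y
  where open ⊕-*-Solver k

⊕≡𝟎⇒≡ : ∀ {x y : V k} → x ⊕ y ≡ 𝟎 → x ≡ y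
⊕≡𝟎⇒≡ {x = x} {y} x⊕y≡𝟎 = begin
  x          ≡⟨ x⊕y⊕y≡x x y ⟨
  x ⊕ y ⊕ y  ≡⟨ cong (_⊕ y) x⊕y≡𝟎 ⟩
  𝟎 ⊕ y      ≡⟨ ⊕-identityˡ y ⟩
  y          ∎
  where open ≡-Reasoning

≡⇒⊕≡𝟎 : ∀ {x y : V k} → x ≡ y → x ⊕ y ≡ 𝟎
≡⇒⊕≡𝟎 {x = x} refl = x⊕x≡𝟎 x

⊕-cancelˡ : ∀ (x : V k) {y z} → x ⊕ y ≡ x ⊕ z → y ≡ z
⊕-cancelˡ {k} x {y} {z} x⊕y≡x⊕z = ⊕≡𝟎⇒≡ (begin
  y ⊕ z                ≡⟨ solve 3 (λ x y z → y :+ z := x :+ y :+ (x :+ z)) refl x y z ⟩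
  x ⊕ y ⊕ (x ⊕ z)      ≡⟨ ≡⇒⊕≡𝟎 x⊕y≡x⊕z ⟩
  𝟎                    ∎)
  where
  open ≡-Reasoning
  open ⊕-*-Solver k

IsAdditive : (V k → V m) → Set
IsAdditive φ = ∀ x y → φ (x ⊕ y) ≡ φ x ⊕ φ y

module _ {φ : V k → V m} (additive : IsAdditive φ) where

  additive⇒𝟎 : φ 𝟎 ≡ 𝟎
  additive⇒𝟎 = begin
    φ 𝟎            ≡⟨ cong φ (⊕-identityˡ 𝟎) ⟨
    φ (𝟎 ⊕ 𝟎)      ≡⟨ additive 𝟎 𝟎 ⟩
    φ 𝟎 ⊕ φ 𝟎      ≡⟨ x⊕x≡𝟎 (φ 𝟎) ⟩
    𝟎              ∎
    where open ≡-Reasoning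

  additive⇒linear : IsLinear φ
  additive⇒linear = additive , homogeneous
    where
    homogeneous : ∀ β x → φ (β · x) ≡ β · φ x
    homogeneous true x = trans (cong φ (map-id x)) (sym (map-id (φ x)))
    homogeneous false x = trans (cong φ (map-const x false)) (trans additive⇒𝟎 (sym (map-const (φ x) false)))

  injective⇔trivialKernel : Injective _≡_ _≡_ φ ⇔ (∀ x → φ x ≡ 𝟎 → x ≡ 𝟎)
  injective⇔trivialKernel = mk⇔
    (λ injective x φx≡𝟎 → injective (trans φx≡𝟎 (sym additive⇒𝟎)))
    (λ trivial {x} {y} φx≡φy → ⊕≡𝟎⇒≡ (trivial (x ⊕ y) (trans (additive x y) (≡⇒⊕≡𝟎 φx≡φy))))

D : (V k → V m) → V k → V k → V m
D h a x = h (x ⊕ a) ⊕ h x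

module _ (h : V k → V m) where

  D⊕B-constant : ∀ a x → D h a x ⊕ B h x a ≡ h a ⊕ h 𝟎
  D⊕B-constant a x = solve 4 (λ hxa hx ha h0 → hxa :+ hx :+ (hxa :+ hx :+ ha :+ h0) := ha :+ h0) refl
    (h (x ⊕ a)) (h x) (h a) (h 𝟎)
    where open ⊕-*-Solver m

  B-sym : ∀ x t → B h x t ≡ B h t x
  B-sym x t = begin
    h (x ⊕ t) ⊕ h x ⊕ h t ⊕ h 𝟎  ≡⟨ cong (λ s → h s ⊕ h x ⊕ h t ⊕ h 𝟎) (⊕-comm x t) ⟩
    h (t ⊕ x) ⊕ h x ⊕ h t ⊕ h 𝟎  ≡⟨ solve 4 (λ s hx ht h0 → s :+ hx :+ ht :+ h0 := s :+ ht :+ hx :+ h0) refl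
                                      (h (t ⊕ x)) (h x) (h t) (h 𝟎) ⟩
    h (t ⊕ x) ⊕ h t ⊕ h x ⊕ h 𝟎  ∎
    where
    open ≡-Reasoning
    open ⊕-*-Solver m

  B-𝟎ˡ : ∀ a → B h 𝟎 a ≡ 𝟎
  B-𝟎ˡ a = begin
    h (𝟎 ⊕ a) ⊕ h 𝟎 ⊕ h a ⊕ h 𝟎  ≡⟨ cong (λ s → h s ⊕ h 𝟎 ⊕ h a ⊕ h 𝟎) (⊕-identityˡ a) ⟩
    h a ⊕ h 𝟎 ⊕ h a ⊕ h 𝟎        ≡⟨ solve 2 (λ ha h0 → ha :+ h0 :+ ha :+ h0 := con false) refl (h a) (h 𝟎) ⟩
    𝟎                            ∎
    where
    open ≡-Reasoning
    open ⊕-*-Solver m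

  B-self : ∀ a → B h a a ≡ 𝟎
  B-self a = begin
    h (a ⊕ a) ⊕ h a ⊕ h a ⊕ h 𝟎  ≡⟨ cong (λ s → h s ⊕ h a ⊕ h a ⊕ h 𝟎) (x⊕x≡𝟎 a) ⟩
    h 𝟎 ⊕ h a ⊕ h a ⊕ h 𝟎        ≡⟨ solve 2 (λ h0 ha → h0 :+ ha :+ ha :+ h0 := con false) refl (h 𝟎) (h a) ⟩
    𝟎                            ∎
    where
    open ≡-Reasoning
    open ⊕-*-Solver m

AtMostTwo : (A → Set) → Set
AtMostTwo P = ∀ {x y z} → P x → P y → P z → x ≢ y → x ≢ z → y ≢ z → ⊥

AtMostTwo-mono : ∀ {P Q : A → Set} → (∀ {x} → P x → Q x) → AtMostTwo Q → AtMostTwo P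
AtMostTwo-mono P⇒Q atMostTwo px py pz = atMostTwo (P⇒Q px) (P⇒Q py) (P⇒Q pz)

∈-tail : ∀ {x w : A} {ws} → x ∈ w ∷ ws → x ≢ w → x ∈ ws
∈-tail (here x≡w) x≢w = ⊥-elim (x≢w x≡w)
∈-tail (there x∈ws) _ = x∈ws

distinct⇒2≤length : ∀ {x y : A} {xs} → x ∈ xs → y ∈ xs → x ≢ y → 2 ≤ length xs
distinct⇒2≤length (here refl) y∈ x≢y = s≤s (∈-length (∈-tail y∈ (x≢y ∘ sym)))
distinct⇒2≤length (there x∈) _ _ = s≤s (∈-length x∈)

distinct⇒3≤length : ∀ {x y z : A} {xs} → x ∈ xs → y ∈ xs → z ∈ xs →
  x ≢ y → x ≢ z → y ≢ z → 3 ≤ length xs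
distinct⇒3≤length (here refl) y∈ z∈ x≢y x≢z y≢z =
  s≤s (distinct⇒2≤length (∈-tail y∈ (x≢y ∘ sym)) (∈-tail z∈ (x≢z ∘ sym)) y≢z)
distinct⇒3≤length (there x∈) (here refl) z∈ _ x≢z y≢z =
  s≤s (distinct⇒2≤length x∈ (∈-tail z∈ (y≢z ∘ sym)) x≢z)
distinct⇒3≤length (there x∈) (there y∈) _ x≢y _ _ = s≤s (distinct⇒2≤length x∈ y∈ x≢y)

AtMostTwo⇒length≤2 : ∀ {xs : List A} → Unique xs → AtMostTwo (_∈ xs) → length xs ≤ 2
AtMostTwo⇒length≤2 {xs = []} _ _ = z≤n
AtMostTwo⇒length≤2 {xs = _ ∷ []} _ _ = s≤s z≤n
AtMostTwo⇒length≤2 {xs = _ ∷ _ ∷ []} _ _ = s≤s (s≤s z≤n)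
AtMostTwo⇒length≤2 {xs = _ ∷ _ ∷ _ ∷ _} ((x≢y ∷ x≢z ∷ _) ∷ (y≢z ∷ _) ∷ _) atMostTwo =
  ⊥-elim (atMostTwo (here refl) (there (here refl)) (there (there (here refl))) x≢y x≢z y≢z)

length≤2⇒AtMostTwo : ∀ {xs : List A} → length xs ≤ 2 → AtMostTwo (_∈ xs)
length≤2⇒AtMostTwo ≤2 x∈ y∈ z∈ x≢y x≢z y≢z =
  <-irrefl refl (≤-trans (distinct⇒3≤length x∈ y∈ z∈ x≢y x≢z y≢z) ≤2)

∈-allV : ∀ (x : V k) → x ∈ allV k
∈-allV [] = here refl
∈-allV (false ∷ x) = ∈-++⁺ˡ (∈-map⁺ (false ∷_) (∈-allV x))
∈-allV {suc k} (true ∷ x) = ∈-++⁺ʳ (List.map (false ∷_) (allV k)) (∈-map⁺ (true ∷_) (∈-allV x))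

allV-unique : ∀ k → Unique (allV k)
allV-unique zero = [] ∷ []
allV-unique (suc k) =
  Unique.++⁺ (Unique.map⁺ (cong Vec.tail) (allV-unique k)) (Unique.map⁺ (cong Vec.tail) (allV-unique k))
             disjoint
  where
  disjoint : ∀ {x} → ¬ (x ∈ List.map (false ∷_) (allV k) × x ∈ List.map (true ∷_) (allV k))
  disjoint (x∈₀ , x∈₁) with ∈-map⁻ (false ∷_) x∈₀ | ∈-map⁻ (true ∷_) x∈₁
  ... | _ , _ , refl | _ , _ , ()

solCount≤2⇔AtMostTwo : ∀ (h : V k → V m) a b → solCount h a b ≤ 2 ⇔ AtMostTwo (λ x → D h a x ≡ b)
solCount≤2⇔AtMostTwo {k} h a b = mk⇔ to from
  where
  P? : Decidable (λ x → D h a x ≡ b)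
  P? x = D h a x ≟V b

  to : solCount h a b ≤ 2 → AtMostTwo (λ x → D h a x ≡ b)
  to ≤2 = AtMostTwo-mono (λ {x} → ∈-filter⁺ P? (∈-allV x)) (length≤2⇒AtMostTwo ≤2)

  from : AtMostTwo (λ x → D h a x ≡ b) → solCount h a b ≤ 2
  from atMostTwo = AtMostTwo⇒length≤2 (Unique.filter⁺ P? (allV-unique k))
    (AtMostTwo-mono (λ x∈ → proj₂ (∈-filter⁻ P? {xs = allV k} x∈)) atMostTwo)

MinimalKernels : (V k → V m) → Set
MinimalKernels h = ∀ a → a ≢ 𝟎 → ∀ w → B h w a ≡ 𝟎 → w ≡ 𝟎 ⊎ w ≡ a

IsAPN⇒MinimalKernels : ∀ (h : V k → V m) → IsAPN h → MinimalKernels h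
IsAPN⇒MinimalKernels h apn a a≢𝟎 w Bwa≡𝟎 with w ≟V 𝟎 | w ≟V a
... | yes w≡𝟎 | _ = inj₁ w≡𝟎
... | no _ | yes w≡a = inj₂ w≡a
... | no w≢𝟎 | no w≢a =
  ⊥-elim (atMostTwo (solves (B-𝟎ˡ h a)) (solves (B-self h a)) (solves Bwa≡𝟎)
                    (a≢𝟎 ∘ sym) (w≢𝟎 ∘ sym) (w≢a ∘ sym))
  where
  atMostTwo : AtMostTwo (λ x → D h a x ≡ h a ⊕ h 𝟎)
  atMostTwo = Equivalence.to (solCount≤2⇔AtMostTwo h a (h a ⊕ h 𝟎)) (apn a a≢𝟎 _)
  solves : ∀ {x} → B h x a ≡ 𝟎 → D h a x ≡ h a ⊕ h 𝟎
  solves {x} Bxa≡𝟎 = begin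
    D h a x             ≡⟨ ⊕-identityʳ _ ⟨
    D h a x ⊕ 𝟎         ≡⟨ cong (D h a x ⊕_) Bxa≡𝟎 ⟨
    D h a x ⊕ B h x a   ≡⟨ D⊕B-constant h a x ⟩
    h a ⊕ h 𝟎           ∎
    where open ≡-Reasoning

MinimalKernels⇒IsAPN : ∀ (h : V k → V m) → (∀ a → IsAdditive (λ x → B h x a)) → MinimalKernels h → IsAPN h
MinimalKernels⇒IsAPN {k} h additive minimal a a≢𝟎 b = Equivalence.from (solCount≤2⇔AtMostTwo h a b) atMostTwo
  where
  Solves : V k → Set
  Solves x = D h a x ≡ b

  B-agrees-on-solutions : ∀ {x y} → Solves x → Solves y → B h x a ≡ B h y a
  B-agrees-on-solutions {x} {y} Dx≡b Dy≡b = ⊕-cancelˡ b (begin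
    b ⊕ B h x a         ≡⟨ cong (_⊕ B h x a) Dx≡b ⟨
    D h a x ⊕ B h x a   ≡⟨ D⊕B-constant h a x ⟩
    h a ⊕ h 𝟎           ≡⟨ D⊕B-constant h a y ⟨
    D h a y ⊕ B h y a   ≡⟨ cong (_⊕ B h y a) Dy≡b ⟩
    b ⊕ B h y a         ∎)
    where open ≡-Reasoning

  distinct⇒⊕≡a : ∀ {x y} → Solves x → Solves y → x ≢ y → x ⊕ y ≡ a
  distinct⇒⊕≡a {x} {y} Dx≡b Dy≡b x≢y =
    [ ⊥-elim ∘ x≢y ∘ ⊕≡𝟎⇒≡ , id ]′
      (minimal a a≢𝟎 (x ⊕ y) (trans (additive a x y) (≡⇒⊕≡𝟎 (B-agrees-on-solutions Dx≡b Dy≡b))))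

  atMostTwo : AtMostTwo Solves
  atMostTwo {x} Dx Dy Dz x≢y x≢z y≢z =
    y≢z (⊕-cancelˡ x (trans (distinct⇒⊕≡a Dx Dy x≢y) (sym (distinct⇒⊕≡a Dx Dz x≢z))))

module Extension {k m : ℕ} (f L : V k → V m) (v : V k) (c : V m)
  (f-quadratic : IsQuadratic f) (L-additive : IsAdditive L)
  (F : V (suc k) → V m)
  (F-hyperplane : ∀ x → F (false ∷ x) ≡ f x)
  (F-coset : ∀ x → F ((false ∷ x) ⊕ (true ∷ v)) ≡ f x ⊕ L x ⊕ c) where

  B-additiveˡ : ∀ a → IsAdditive (λ x → B f x a)
  B-additiveˡ a = proj₁ (proj₁ f-quadratic a)

  B-additiveʳ : ∀ x → IsAdditive (B f x)
  B-additiveʳ x = proj₁ (proj₂ f-quadratic x)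

  M : V k → V k → V m
  M A x = L x ⊕ B f x A

  M-additive : ∀ A → IsAdditive (M A)
  M-additive A x y = begin
    L (x ⊕ y) ⊕ B f (x ⊕ y) A
      ≡⟨ cong₂ _⊕_ (L-additive x y) (B-additiveˡ A x y) ⟩
    (L x ⊕ L y) ⊕ (B f x A ⊕ B f y A)
      ≡⟨ solve 4 (λ Lx Ly Bx By → (Lx :+ Ly) :+ (Bx :+ By) := (Lx :+ Bx) :+ (Ly :+ By))
                 refl (L x) (L y) (B f x A) (B f y A) ⟩
    (L x ⊕ B f x A) ⊕ (L y ⊕ B f y A)
      ∎
    where
    open ≡-Reasoning
    open ⊕-*-Solver m

  M-shift : ∀ A a x → M A x ⊕ B f x a ≡ M (a ⊕ A) x
  M-shift A a x = begin
    L x ⊕ B f x A ⊕ B f x a    ≡⟨ solve 3 (λ Lx BA Ba → Lx :+ BA :+ Ba := Lx :+ (Ba :+ BA))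
                                          refl (L x) (B f x A) (B f x a) ⟩
    L x ⊕ (B f x a ⊕ B f x A)  ≡⟨ cong (L x ⊕_) (B-additiveʳ x a A) ⟨
    L x ⊕ B f x (a ⊕ A)        ∎
    where
    open ≡-Reasoning
    open ⊕-*-Solver m

  d : V m
  d = f v ⊕ f 𝟎 ⊕ L v ⊕ c

  F-uniform : ∀ β x → F (β ∷ x) ≡ f x ⊕ ⟨ β ⟩ * (M v x ⊕ d)
  F-uniform false x = begin
    F (false ∷ x)           ≡⟨ F-hyperplane x ⟩
    f x                     ≡⟨ solve 2 (λ fx y → fx := fx :+ con false :* y) refl (f x) (M v x ⊕ d) ⟩
    f x ⊕ 𝟎 * (M v x ⊕ d)  ∎
    where
    open ≡-Reasoning
    open ⊕-*-Solver m
  F-uniform true x = begin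
    F (true ∷ x)
      ≡⟨ cong (λ y → F (true ∷ y)) (x⊕y⊕y≡x x v) ⟨
    F (true ∷ (x ⊕ v ⊕ v))
      ≡⟨ F-coset (x ⊕ v) ⟩
    f (x ⊕ v) ⊕ L (x ⊕ v) ⊕ c
      ≡⟨ cong (λ y → f (x ⊕ v) ⊕ y ⊕ c) (L-additive x v) ⟩
    f (x ⊕ v) ⊕ (L x ⊕ L v) ⊕ c
      ≡⟨ solve 7 (λ fxv fx fv f0 Lx Lv c →
                     fxv :+ (Lx :+ Lv) :+ c
                  := fx :+ con true :* (Lx :+ (fxv :+ fx :+ fv :+ f0) :+ (fv :+ f0 :+ Lv :+ c)))
                 refl (f (x ⊕ v)) (f x) (f v) (f 𝟎) (L x) (L v) c ⟩
    f x ⊕ ⟨ true ⟩ * (M v x ⊕ d)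
      ∎
    where
    open ≡-Reasoning
    open ⊕-*-Solver m

  B-F : ∀ β x α a → B F (β ∷ x) (α ∷ a) ≡ B f x a ⊕ ⟨ β ⟩ * M v a ⊕ ⟨ α ⟩ * M v x
  B-F β x α a = begin
    B F (β ∷ x) (α ∷ a)
      ≡⟨ cong₂ _⊕_ (cong₂ _⊕_ (cong₂ _⊕_ (F-uniform (β xor α) (x ⊕ a)) (F-uniform β x)) (F-uniform α a))
                   (F-hyperplane 𝟎) ⟩
    f (x ⊕ a) ⊕ ⟨ β xor α ⟩ * (M v (x ⊕ a) ⊕ d) ⊕ (f x ⊕ ⟨ β ⟩ * (M v x ⊕ d))
      ⊕ (f a ⊕ ⟨ α ⟩ * (M v a ⊕ d)) ⊕ f 𝟎
      ≡⟨ cong₂ (λ s y → f (x ⊕ a) ⊕ s * (y ⊕ d) ⊕ (f x ⊕ ⟨ β ⟩ * (M v x ⊕ d))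
                          ⊕ (f a ⊕ ⟨ α ⟩ * (M v a ⊕ d)) ⊕ f 𝟎)
               (⟨⟩-xor β α) (M-additive v x a) ⟩
    f (x ⊕ a) ⊕ (⟨ β ⟩ ⊕ ⟨ α ⟩) * (M v x ⊕ M v a ⊕ d) ⊕ (f x ⊕ ⟨ β ⟩ * (M v x ⊕ d))
      ⊕ (f a ⊕ ⟨ α ⟩ * (M v a ⊕ d)) ⊕ f 𝟎
      ≡⟨ solve 9 (λ fxa fx fa f0 β α Mx Ma d →
            fxa :+ (β :+ α) :* (Mx :+ Ma :+ d) :+ (fx :+ β :* (Mx :+ d)) :+ (fa :+ α :* (Ma :+ d)) :+ f0
         := fxa :+ fx :+ fa :+ f0 :+ β :* Ma :+ α :* Mx)
         refl (f (x ⊕ a)) (f x) (f a) (f 𝟎) ⟨ β ⟩ ⟨ α ⟩ (M v x) (M v a) d ⟩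
    B f x a ⊕ ⟨ β ⟩ * M v a ⊕ ⟨ α ⟩ * M v x
      ∎
    where
    open ≡-Reasoning
    open ⊕-*-Solver m

  B-F-additiveˡ : ∀ T → IsAdditive (λ X → B F X T)
  B-F-additiveˡ (α ∷ a) (β ∷ x) (γ ∷ y) = begin
    B F ((β xor γ) ∷ (x ⊕ y)) (α ∷ a)
      ≡⟨ B-F (β xor γ) (x ⊕ y) α a ⟩
    B f (x ⊕ y) a ⊕ ⟨ β xor γ ⟩ * M v a ⊕ ⟨ α ⟩ * M v (x ⊕ y)
      ≡⟨ cong₂ (λ s t → B f (x ⊕ y) a ⊕ s * M v a ⊕ ⟨ α ⟩ * t) (⟨⟩-xor β γ) (M-additive v x y) ⟩
    B f (x ⊕ y) a ⊕ (⟨ β ⟩ ⊕ ⟨ γ ⟩) * M v a ⊕ ⟨ α ⟩ * (M v x ⊕ M v y)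
      ≡⟨ cong (λ s → s ⊕ (⟨ β ⟩ ⊕ ⟨ γ ⟩) * M v a ⊕ ⟨ α ⟩ * (M v x ⊕ M v y)) (B-additiveˡ a x y) ⟩
    B f x a ⊕ B f y a ⊕ (⟨ β ⟩ ⊕ ⟨ γ ⟩) * M v a ⊕ ⟨ α ⟩ * (M v x ⊕ M v y)
      ≡⟨ solve 8 (λ Bx By β γ α Ma Mx My →
            Bx :+ By :+ (β :+ γ) :* Ma :+ α :* (Mx :+ My)
         := (Bx :+ β :* Ma :+ α :* Mx) :+ (By :+ γ :* Ma :+ α :* My))
         refl (B f x a) (B f y a) ⟨ β ⟩ ⟨ γ ⟩ ⟨ α ⟩ (M v a) (M v x) (M v y) ⟩
    (B f x a ⊕ ⟨ β ⟩ * M v a ⊕ ⟨ α ⟩ * M v x) ⊕ (B f y a ⊕ ⟨ γ ⟩ * M v a ⊕ ⟨ α ⟩ * M v y)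
      ≡⟨ cong₂ _⊕_ (B-F β x α a) (B-F γ y α a) ⟨
    B F (β ∷ x) (α ∷ a) ⊕ B F (γ ∷ y) (α ∷ a)
      ∎
    where
    open ≡-Reasoning
    open ⊕-*-Solver m

  isQuadratic : IsQuadratic F
  isQuadratic = (λ T → additive⇒linear (B-F-additiveˡ T)) , (λ X → additive⇒linear (B-F-additiveʳ X))
    where
    B-F-additiveʳ : ∀ X → IsAdditive (B F X)
    B-F-additiveʳ X T S = begin
      B F X (T ⊕ S)          ≡⟨ B-sym F X (T ⊕ S) ⟩
      B F (T ⊕ S) X          ≡⟨ B-F-additiveˡ X T S ⟩
      B F T X ⊕ B F S X      ≡⟨ cong₂ _⊕_ (B-sym F T X) (B-sym F S X) ⟩
      B F X T ⊕ B F X S      ∎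
      where open ≡-Reasoning

  module _ (w a : V k) where
    open ⊕-*-Solver m
    open ≡-Reasoning

    B-F-false-false : B F (false ∷ w) (false ∷ a) ≡ B f w a
    B-F-false-false = begin
      B F (false ∷ w) (false ∷ a)
        ≡⟨ B-F false w false a ⟩
      B f w a ⊕ 𝟎 * M v a ⊕ 𝟎 * M v w
        ≡⟨ solve 3 (λ b Ma Mw → b :+ con false :* Ma :+ con false :* Mw := b) refl (B f w a) (M v a) (M v w) ⟩
      B f w a
        ∎

    B-F-true-false : B F (true ∷ w) (false ∷ a) ≡ M (w ⊕ v) a
    B-F-true-false = begin
      B F (true ∷ w) (false ∷ a)
        ≡⟨ B-F true w false a ⟩
      B f w a ⊕ ⟨ true ⟩ * M v a ⊕ 𝟎 * M v w
        ≡⟨ solve 3 (λ b Ma Mw → b :+ con true :* Ma :+ con false :* Mw := Ma :+ b) refl (B f w a) (M v a) (M v w) ⟩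
      M v a ⊕ B f w a
        ≡⟨ cong (M v a ⊕_) (B-sym f w a) ⟩
      M v a ⊕ B f a w
        ≡⟨ M-shift v w a ⟩
      M (w ⊕ v) a
        ∎

    B-F-false-true : B F (false ∷ w) (true ∷ a) ≡ M (a ⊕ v) w
    B-F-false-true = begin
      B F (false ∷ w) (true ∷ a)
        ≡⟨ B-F false w true a ⟩
      B f w a ⊕ 𝟎 * M v a ⊕ ⟨ true ⟩ * M v w
        ≡⟨ solve 3 (λ b Ma Mw → b :+ con false :* Ma :+ con true :* Mw := Mw :+ b) refl (B f w a) (M v a) (M v w) ⟩
      M v w ⊕ B f w a
        ≡⟨ M-shift v a w ⟩
      M (a ⊕ v) w
        ∎

    B-F-true-true : B F (true ∷ w) (true ∷ a) ≡ M (a ⊕ v) (w ⊕ a)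
    B-F-true-true = begin
      B F (true ∷ w) (true ∷ a)
        ≡⟨ B-F true w true a ⟩
      B f w a ⊕ ⟨ true ⟩ * M v a ⊕ ⟨ true ⟩ * M v w
        ≡⟨ solve 3 (λ b Ma Mw → b :+ con true :* Ma :+ con true :* Mw := (Mw :+ b) :+ (Ma :+ con false))
                   refl (B f w a) (M v a) (M v w) ⟩
      (M v w ⊕ B f w a) ⊕ (M v a ⊕ 𝟎)
        ≡⟨ cong (λ s → (M v w ⊕ B f w a) ⊕ (M v a ⊕ s)) (B-self f a) ⟨
      (M v w ⊕ B f w a) ⊕ (M v a ⊕ B f a a)
        ≡⟨ cong₂ _⊕_ (M-shift v a w) (M-shift v a a) ⟩
      M (a ⊕ v) w ⊕ M (a ⊕ v) a
        ≡⟨ M-additive (a ⊕ v) w a ⟨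
      M (a ⊕ v) (w ⊕ a)
        ∎

  injective⇒MinimalKernels : MinimalKernels f → (∀ A → Injective _≡_ _≡_ (M A)) → MinimalKernels F
  injective⇒MinimalKernels minimal injective = kernels
    where
    M-kernel : ∀ A x → M A x ≡ 𝟎 → x ≡ 𝟎
    M-kernel A = Equivalence.to (injective⇔trivialKernel (M-additive A)) (injective A)

    kernels : MinimalKernels F
    kernels (false ∷ a) a'≢𝟎 (false ∷ w) B≡𝟎 =
      Sum.map (cong (false ∷_)) (cong (false ∷_))
        (minimal a (a'≢𝟎 ∘ cong (false ∷_)) w (trans (sym (B-F-false-false w a)) B≡𝟎))
    kernels (false ∷ a) a'≢𝟎 (true ∷ w) B≡𝟎 =
      ⊥-elim (a'≢𝟎 (cong (false ∷_) (M-kernel (w ⊕ v) a (trans (sym (B-F-true-false w a)) B≡𝟎))))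
    kernels (true ∷ a) _ (false ∷ w) B≡𝟎 =
      inj₁ (cong (false ∷_) (M-kernel (a ⊕ v) w (trans (sym (B-F-false-true w a)) B≡𝟎)))
    kernels (true ∷ a) _ (true ∷ w) B≡𝟎 =
      inj₂ (cong (true ∷_) (⊕≡𝟎⇒≡ (M-kernel (a ⊕ v) (w ⊕ a) (trans (sym (B-F-true-true w a)) B≡𝟎))))

  MinimalKernels⇒injective : MinimalKernels F → ∀ A → Injective _≡_ _≡_ (M A)
  MinimalKernels⇒injective minimal A = Equivalence.from (injective⇔trivialKernel (M-additive A)) trivialKernel
    where
    trivialKernel : ∀ z → M A z ≡ 𝟎 → z ≡ 𝟎
    trivialKernel z MAz≡𝟎 = [ cong Vec.tail , (λ ()) ]′ (minimal (true ∷ (A ⊕ v)) (λ ()) (false ∷ z) B≡𝟎)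
      where
      B≡𝟎 : B F (false ∷ z) (true ∷ (A ⊕ v)) ≡ 𝟎
      B≡𝟎 = trans (B-F-false-true z (A ⊕ v)) (trans (cong (λ s → M s z) (x⊕y⊕y≡x A v)) MAz≡𝟎)

proposition3 : ∀ (k m : ℕ) (f g L : V k → V m) (c : V m) (v : V k)
    → IsQuadratic f → IsAPN f → IsQuadratic g → IsAPN g
    → IsLinear L → (∀ x → g x ≡ f x ⊕ L x ⊕ c)
    → (F : V (suc k) → V m)
    → (∀ x → F (false ∷ x) ≡ f x)
    → (∀ x → F ((false ∷ x) ⊕ (true ∷ v)) ≡ f x ⊕ L x ⊕ c)
    → ((IsQuadratic F × IsAPN F)
       ⇔ (∀ (A : V k) → Injective _≡_ _≡_ (λ x → L x ⊕ B f x A)))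
proposition3 k m f _ L c v quadratic apn _ _ linear _ F F-hyperplane F-coset = mk⇔
  (λ (_ , apnF) → MinimalKernels⇒injective (IsAPN⇒MinimalKernels F apnF))
  (λ injective → isQuadratic ,
     MinimalKernels⇒IsAPN F B-F-additiveˡ (injective⇒MinimalKernels (IsAPN⇒MinimalKernels f apn) injective))
  where open Extension f L v c quadratic (proj₁ linear) F F-hyperplane F-coset
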